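{- Let $S$ be a numerical semigroup such that $\mathrm{F}(S) > 2\,\mathrm{m}(S)$. Then $\overline{S} = (S \setminus \{\mathrm{m}(S)\}) \cup \{\mathrm{F}(S) - \mathrm{m}(S)\}$ is a numerical semigroup with $\mathrm{F}(\overline{S}) = \mathrm{F}(S)$, $\mathrm{g}(\overline{S}) = \mathrm{g}(S)$ and $\mathrm{m}(\overline{S}) > \mathrm{m}(S)$. Moreover, $\overline{S} \in [S]$, i.e. $\theta(\overline{S}) = \theta(S)$, where $\theta$ is taken with respect to $F = \mathrm{F}(S)$ and $g = \mathrm{g}(S)$.
   Context: A numerical semigroup is a subset $S \subseteq \mathbb{N}$ (with $\mathbb{N}$ the nonnegative integers) closed under addition, containing $0$, with $\mathbb{N}\setminus S$ finite. The genus $\mathrm{g}(S)$ is $\#(\mathbb{N}\setminus S)$; the Frobenius number $\mathrm{F}(S)$ is the largest integer not in $S$; the multiplicity $\mathrm{m}(S)$ is the least positive integer in $S$. $\mathcal{S}(F,g)$ denotes the set of numerical semigroups with Frobenius number $F$ and genus $g$. For $S \in \mathcal{S}(F,g)$ define $\theta(S) = \left(S \setminus \{x \in S\setminus\{0\} : x < \frac{F}{2}\}\right) \cup \{F - x : x \in S\setminus\{0\},\ x < \frac{F}{2}\}$, and for $S \in \mathcal{S}(F,g)$ let $[S] = \{S' \in \mathcal{S}(F,g) : \theta(S') = \theta(S)\}$. -}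

module Defs where

open import Data.Nat using (ℕ; zero; suc; _+_; _*_; _∸_; _≤_; _<_; _≡ᵇ_)
open import Data.Bool using (Bool; true; false; not; _∧_; _∨_)
open import Data.Product using (Σ; _×_; ∃)
open import Relation.Binary.PropositionalEquality using (_≡_)
open import Data.Sum using (_⊎_)
open import Relation.Nullary using (¬_)

-- A subset of ℕ, given by its (decidable) membership function.
-- (Numerical semigroups are cofinite, hence decidable subsets of ℕ.)
Subsetℕ : Set
Subsetℕ = ℕ → Bool

record IsNumericalSemigroup (S : Subsetℕ) : Set where
  field
    zero∈ : S 0 ≡ true
    +-closed : ∀ x y → S x ≡ true → S y ≡ true → S (x + y) ≡ true
    cofinite : ∃ λ b → ∀ n → b ≤ n → S n ≡ true

countGaps : Subsetℕ → ℕ → ℕ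
countGaps S zero = 0
countGaps S (suc n) with S n
... | true  = countGaps S n
... | false = suc (countGaps S n)

IsFrobenius : Subsetℕ → ℕ → Set
IsFrobenius S F = (S F ≡ false) × (∀ n → F < n → S n ≡ true)

IsMultiplicity : Subsetℕ → ℕ → Set
IsMultiplicity S m = (0 < m) × (S m ≡ true) × (∀ k → 0 < k → k < m → S k ≡ false)

IsGenus : Subsetℕ → ℕ → Set
IsGenus S g = Σ ℕ λ b → (∀ n → b ≤ n → S n ≡ true) × (countGaps S b ≡ g)

bar : Subsetℕ → ℕ → ℕ → Subsetℕ
bar S F m n = (S n ∧ not (n ≡ᵇ m)) ∨ (n ≡ᵇ (F ∸ m))

-- θ(S) w.r.t. Frobenius number F, as a (propositional) predicate:
-- θ(S) = (S ∖ {x ∈ S∖{0} : x < F/2}) ∪ {F - x : x ∈ S∖{0}, x < F/2}.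
-- (x < F/2 is written 2 * x < F.)
θ : ℕ → Subsetℕ → ℕ → Set
θ F S n =
  ((S n ≡ true) × (¬small n))
  ⊎ (Σ ℕ λ x → (S x ≡ true) × (0 < x) × (2 * x < F) × (n ≡ F ∸ x))
  where
    ¬small : ℕ → Set
    ¬small k = ¬ ((0 < k) × (2 * k < F))

-- Every nonzero element of S other than m exceeds m, so adding d = F − m to any
-- positive element of the new set gives more than m + d = F; hence removing m and
-- adding d keeps S closed under addition. As m + d = F ∉ S, d is a gap of S, so
-- an element is exchanged for a gap and the genus is unchanged, while every
-- positive element of the new set exceeds m. Finally m < F/2 < d, and θ replaces
-- m by F − m = d, so θ cannot tell S and its exchange apart.
module Submission where

open import Defs
open import Data.Nat using (ℕ; _*_; _∸_; _<_)
open import Data.Product using (Σ; _×_)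
open import Function.Bundles using (_⇔_)

open import Data.Nat using (zero; suc; _+_; _≤_; _≡ᵇ_; s≤s; z<s; _≟_; _<?_)
open import Data.Nat.Properties
open import Data.Nat.Induction using (<-rec)
open import Data.Bool using (Bool; true; false; if_then_else_)
open import Data.Bool.Properties using (¬-not; T-≡)
open import Data.Product using (∃; _,_; proj₁; proj₂)
open import Data.Sum using (_⊎_; inj₁; inj₂)
open import Relation.Nullary using (yes; no; contradiction)
open import Relation.Nullary.Decidable using (_×-dec_)
open import Relation.Binary.PropositionalEquality
open import Function.Bundles using (mk⇔; Equivalence)
open import Algebra.Properties.CommutativeSemigroup +-commutativeSemigroup using (interchange)
import Data.Bool.Properties as Bool

≡ᵇ-refl : ∀ n → (n ≡ᵇ n) ≡ true
≡ᵇ-refl n = Equivalence.to T-≡ (≡⇒≡ᵇ n n refl)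

≢⇒≡ᵇ-false : ∀ {m n} → m ≢ n → (m ≡ᵇ n) ≡ false
≢⇒≡ᵇ-false {m} {n} m≢n = ¬-not (λ eq → m≢n (≡ᵇ⇒≡ m n (Equivalence.from T-≡ eq)))

true≢false : ∀ {b : Bool} → b ≡ true → b ≢ false
true≢false refl ()

half<complement : ∀ {a F} → 2 * a < F → a < F ∸ a
half<complement {a} {F} 2a<F = +-cancelˡ-< a a (F ∸ a) (begin-strict
    a + a         ≡⟨ cong (a +_) (sym (+-identityʳ a)) ⟩
    2 * a         <⟨ 2a<F ⟩
    F             ≡⟨ sym (m+[n∸m]≡n (≤-trans (m≤m+n a (a + 0)) (<⇒≤ 2a<F))) ⟩
    a + (F ∸ a)   ∎)
  where open ≤-Reasoning

complement-of-half-is-not-half : ∀ {a x F} → 2 * a < F → 2 * x < F → x ≢ F ∸ a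
complement-of-half-is-not-half {a} {x} {F} 2a<F 2x<F refl =
  <-asym (half<complement 2a<F)
    (subst (F ∸ a <_) (m∸[m∸n]≡n (<⇒≤ (≤-<-trans (m≤m+n a (a + 0)) 2a<F)))
      (half<complement 2x<F))

record IsExchange (S T : Subsetℕ) (a b : ℕ) : Set where
  field
    a≢b   : a ≢ b
    a∈S   : S a ≡ true
    a∉T   : T a ≡ false
    b∉S   : S b ≡ false
    b∈T   : T b ≡ true
    agree : ∀ k → k ≢ a → k ≢ b → T k ≡ S k

  ∈T-from-∈S : ∀ {k} → S k ≡ true → k ≢ a → T k ≡ true
  ∈T-from-∈S {k} Sk k≢a with k ≟ b
  ... | yes refl = b∈T
  ... | no k≢b   = trans (agree k k≢a k≢b) Sk

  ∈T-cases : ∀ {k} → T k ≡ true → (S k ≡ true × k ≢ a) ⊎ k ≡ b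
  ∈T-cases {k} Tk with k ≟ b | k ≟ a
  ... | yes k≡b | _        = inj₂ k≡b
  ... | no _    | yes refl = contradiction a∉T (true≢false Tk)
  ... | no k≢b  | no k≢a   = inj₁ (trans (sym (agree k k≢a k≢b)) Tk , k≢a)

bar-isExchange : ∀ {S F m} → m ≢ F ∸ m → S m ≡ true → S (F ∸ m) ≡ false →
                 IsExchange S (bar S F m) m (F ∸ m)
bar-isExchange {S} {F} {m} m≢d Sm Sd = record
  { a≢b = m≢d ; a∈S = Sm ; a∉T = dropped ; b∉S = Sd ; b∈T = added ; agree = agree }
  where
  dropped : bar S F m m ≡ false
  dropped rewrite ≡ᵇ-refl m | ≢⇒≡ᵇ-false m≢d | Bool.∧-zeroʳ (S m) = refl

  added : bar S F m (F ∸ m) ≡ true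
  added rewrite ≡ᵇ-refl (F ∸ m) = Bool.∨-zeroʳ _

  agree : ∀ k → k ≢ m → k ≢ F ∸ m → bar S F m k ≡ S k
  agree k k≢m k≢d rewrite ≢⇒≡ᵇ-false k≢m | ≢⇒≡ᵇ-false k≢d
    | Bool.∧-identityʳ (S k) = Bool.∨-identityʳ (S k)

countGaps-suc : ∀ S n → countGaps S (suc n) ≡ (if S n then 0 else 1) + countGaps S n
countGaps-suc S n with S n
... | true  = refl
... | false = refl

countGaps-stable : ∀ {S b} → (∀ n → b ≤ n → S n ≡ true) → ∀ k → countGaps S (b + k) ≡ countGaps S b
countGaps-stable {S} {b} _ zero = cong (countGaps S) (+-identityʳ b)
countGaps-stable {S} {b} above (suc k)
  rewrite +-suc b k | countGaps-suc S (b + k) | above (b + k) (m≤m+n b k) = countGaps-stable above k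

count≡ : ℕ → ℕ → ℕ
count≡ a zero    = 0
count≡ a (suc n) = (if n ≡ᵇ a then 1 else 0) + count≡ a n

count≡-≤ : ∀ {a n} → n ≤ a → count≡ a n ≡ 0
count≡-≤ {a} {zero}  _   = refl
count≡-≤ {a} {suc n} n<a rewrite ≢⇒≡ᵇ-false (<⇒≢ n<a) = count≡-≤ (<⇒≤ n<a)

count≡-> : ∀ {a n} → a < n → count≡ a n ≡ 1
count≡-> {a} {suc n} (s≤s a≤n) with n ≟ a
... | yes refl rewrite ≡ᵇ-refl n = cong suc (count≡-≤ {n} ≤-refl)
... | no n≢a   rewrite ≢⇒≡ᵇ-false n≢a = count≡-> (≤∧≢⇒< a≤n (≢-sym n≢a))

module _ {S T : Subsetℕ} {a b : ℕ} (ex : IsExchange S T a b) where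
  open IsExchange ex

  private
    balance-at : ∀ k → (if T k then 0 else 1) + (if k ≡ᵇ b then 1 else 0)
                     ≡ (if S k then 0 else 1) + (if k ≡ᵇ a then 1 else 0)
    balance-at k with k ≟ a | k ≟ b
    ... | yes refl | _ rewrite a∉T | a∈S | ≢⇒≡ᵇ-false a≢b | ≡ᵇ-refl k = refl
    ... | no k≢a | yes refl rewrite b∈T | b∉S | ≢⇒≡ᵇ-false k≢a | ≡ᵇ-refl k = refl
    ... | no k≢a | no k≢b rewrite agree k k≢a k≢b | ≢⇒≡ᵇ-false k≢a | ≢⇒≡ᵇ-false k≢b = refl

    balance : ∀ n → countGaps T n + count≡ b n ≡ countGaps S n + count≡ a n
    balance zero    = refl
    balance (suc n) rewrite countGaps-suc T n | countGaps-suc S n = begin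
      (gapT + countGaps T n) + (atB + count≡ b n) ≡⟨ interchange gapT _ atB _ ⟩
      (gapT + atB) + (countGaps T n + count≡ b n) ≡⟨ cong₂ _+_ (balance-at n) (balance n) ⟩
      (gapS + atA) + (countGaps S n + count≡ a n) ≡⟨ interchange gapS atA _ _ ⟩
      (gapS + countGaps S n) + (atA + count≡ a n) ∎
      where
      open ≡-Reasoning
      gapT gapS atA atB : ℕ
      gapT = if T n then 0 else 1
      gapS = if S n then 0 else 1
      atA  = if n ≡ᵇ a then 1 else 0
      atB  = if n ≡ᵇ b then 1 else 0

  countGaps-exchange : ∀ n → a < n → b < n → countGaps T n ≡ countGaps S n
  countGaps-exchange n a<n b<n = +-cancelʳ-≡ 1 _ _ (begin
    countGaps T n + 1          ≡⟨ cong (countGaps T n +_) (sym (count≡-> b<n)) ⟩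
    countGaps T n + count≡ b n ≡⟨ balance n ⟩
    countGaps S n + count≡ a n ≡⟨ cong (countGaps S n +_) (count≡-> a<n) ⟩
    countGaps S n + 1          ∎)
    where open ≡-Reasoning

  IsGenus-exchange : ∀ {c} → a < c → b < c → (∀ n → c ≤ n → T n ≡ true) →
                     ∀ g → IsGenus S g → IsGenus T g
  IsGenus-exchange {c} a<c b<c T-above g (b₀ , S-above , gaps≡g) =
    b₀ + c , (λ n c≤n → T-above n (≤-trans (m≤n+m c b₀) c≤n)) , (begin
      countGaps T (b₀ + c) ≡⟨ countGaps-exchange (b₀ + c) (<-≤-trans a<c c≤b₀+c) (<-≤-trans b<c c≤b₀+c) ⟩
      countGaps S (b₀ + c) ≡⟨ countGaps-stable S-above c ⟩
      countGaps S b₀       ≡⟨ gaps≡g ⟩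
      g                    ∎)
    where
    open ≡-Reasoning
    c≤b₀+c : c ≤ b₀ + c
    c≤b₀+c = m≤n+m c b₀

  θ-exchange : ∀ {F} → b ≡ F ∸ a → 0 < a → 2 * a < F → ∀ n → θ F T n ⇔ θ F S n
  θ-exchange {F} refl 0<a 2a<F n = mk⇔ to from
    where
    to : θ F T n → θ F S n
    to (inj₁ (Tn , large)) with ∈T-cases Tn
    ... | inj₁ (Sn , _) = inj₁ (Sn , large)
    ... | inj₂ n≡b      = inj₂ (a , a∈S , 0<a , 2a<F , n≡b)
    to (inj₂ (x , Tx , 0<x , 2x<F , n≡F∸x)) with ∈T-cases Tx
    ... | inj₁ (Sx , _) = inj₂ (x , Sx , 0<x , 2x<F , n≡F∸x)
    ... | inj₂ x≡b      = contradiction x≡b (complement-of-half-is-not-half {a} {x} 2a<F 2x<F)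

    from : θ F S n → θ F T n
    from (inj₁ (Sn , large)) = inj₁ (∈T-from-∈S Sn (λ { refl → large (0<a , 2a<F) }) , large)
    from (inj₂ (x , Sx , 0<x , 2x<F , n≡F∸x)) with x ≟ a
    ... | yes refl = inj₁ (subst (λ k → T k ≡ true) (sym n≡F∸x) b∈T ,
                           λ { (_ , 2n<F) → complement-of-half-is-not-half {x} {n} 2x<F 2n<F n≡F∸x })
    ... | no x≢a   = inj₂ (x , ∈T-from-∈S Sx x≢a , 0<x , 2x<F , n≡F∸x)

multiplicity-≤ : ∀ {S m x} → IsMultiplicity S m → S x ≡ true → 0 < x → m ≤ x
multiplicity-≤ (_ , _ , below) Sx 0<x = ≮⇒≥ (λ x<m → true≢false Sx (below _ 0<x x<m))

sum-≢-multiplicity : ∀ {S m} x y → IsMultiplicity S m → S x ≡ true → x ≢ m → y ≢ m → x + y ≢ m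
sum-≢-multiplicity zero y _ _ _ y≢m = y≢m
sum-≢-multiplicity {m = m} (suc x) zero _ _ x≢m _ = subst (_≢ m) (sym (+-identityʳ (suc x))) x≢m
sum-≢-multiplicity {m = m} (suc x) (suc y) μ Sx _ _ x+y≡m =
  <⇒≢ (<-≤-trans (m<m+n m z<s) (+-monoˡ-≤ (suc y) (multiplicity-≤ μ Sx z<s))) (sym x+y≡m)

multiplicity-exists : ∀ (S : Subsetℕ) x → 0 < x → S x ≡ true → ∃ λ m → IsMultiplicity S m
multiplicity-exists S = <-rec _ least
  where
  least : ∀ x → (∀ {y} → y < x → 0 < y → S y ≡ true → ∃ λ m → IsMultiplicity S m) →
          0 < x → S x ≡ true → ∃ λ m → IsMultiplicity S m
  least x smaller 0<x Sx with anyUpTo? (λ j → (0 <? j) ×-dec (S j Bool.≟ true)) x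
  ... | yes (j , j<x , 0<j , Sj) = smaller j<x 0<j Sj
  ... | no none = x , 0<x , Sx , λ k 0<k k<x → ¬-not (λ Sk → none (k , k<x , 0<k , Sk))

module SmallMultiplicityExchange
  {S : Subsetℕ} {F m : ℕ} (S-ns : IsNumericalSemigroup S)
  (F-frob : IsFrobenius S F) (m-mult : IsMultiplicity S m) (2m<F : 2 * m < F) where

  open IsNumericalSemigroup S-ns

  d : ℕ
  d = F ∸ m

  B : Subsetℕ
  B = bar S F m

  0<m : 0 < m
  0<m = proj₁ m-mult

  m<d : m < d
  m<d = half<complement 2m<F

  m<F : m < F
  m<F = ≤-<-trans (m≤m+n m (m + 0)) 2m<F

  d<F : d < F
  d<F = ∸-monoʳ-< 0<m (<⇒≤ m<F)

  m+d≡F : m + d ≡ F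
  m+d≡F = m+[n∸m]≡n (<⇒≤ m<F)

  d∉S : S d ≡ false
  d∉S = ¬-not λ Sd → true≢false (subst (λ k → S k ≡ true) m+d≡F (+-closed m d (proj₁ (proj₂ m-mult)) Sd))
                                (proj₁ F-frob)

  exchange : IsExchange S B m d
  exchange = bar-isExchange (<⇒≢ m<d) (proj₁ (proj₂ m-mult)) d∉S

  open IsExchange exchange

  B-above-F : ∀ n → F < n → B n ≡ true
  B-above-F n F<n = ∈T-from-∈S (proj₂ F-frob n F<n) (λ { refl → <-asym m<F F<n })

  B-positive : ∀ {x} → B x ≡ true → 0 < x → m < x
  B-positive Bx 0<x with ∈T-cases Bx
  ... | inj₁ (Sx , x≢m) = ≤∧≢⇒< (multiplicity-≤ m-mult Sx 0<x) (≢-sym x≢m)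
  ... | inj₂ refl       = m<d

  B-+d : ∀ x → B x ≡ true → B (x + d) ≡ true
  B-+d zero    _  = b∈T
  B-+d (suc x) Bx = B-above-F (suc x + d) (subst (_< suc x + d) m+d≡F (+-monoˡ-< d (B-positive Bx z<s)))

  B-+-closed : ∀ x y → B x ≡ true → B y ≡ true → B (x + y) ≡ true
  B-+-closed x y Bx By with ∈T-cases Bx | ∈T-cases By
  ... | _               | inj₂ refl       = B-+d x Bx
  ... | inj₂ refl       | inj₁ _          = subst (λ k → B k ≡ true) (+-comm y d) (B-+d y By)
  ... | inj₁ (Sx , x≢m) | inj₁ (Sy , y≢m) =
    ∈T-from-∈S (+-closed x y Sx Sy) (sum-≢-multiplicity x y m-mult Sx x≢m y≢m)

  B-isNumericalSemigroup : IsNumericalSemigroup B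
  B-isNumericalSemigroup = record
    { zero∈    = ∈T-from-∈S zero∈ (<⇒≢ 0<m)
    ; +-closed = B-+-closed
    ; cofinite = suc F , B-above-F }

  B-isFrobenius : IsFrobenius B F
  B-isFrobenius = trans (agree F (≢-sym (<⇒≢ m<F)) (≢-sym (<⇒≢ d<F))) (proj₁ F-frob) , B-above-F

  B-isGenus : ∀ g → IsGenus S g → IsGenus B g
  B-isGenus = IsGenus-exchange exchange (<-trans m<F (n<1+n F)) (<-trans d<F (n<1+n F)) B-above-F

  B-multiplicity : Σ ℕ λ m′ → IsMultiplicity B m′ × (m < m′)
  B-multiplicity with multiplicity-exists B d (<-trans 0<m m<d) b∈T
  ... | m′ , μ′@(0<m′ , Bm′ , _) = m′ , μ′ , B-positive Bm′ 0<m′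

lemma8 : (S : Subsetℕ) → IsNumericalSemigroup S →
    (F m : ℕ) → IsFrobenius S F → IsMultiplicity S m → 2 * m < F →
    IsNumericalSemigroup (bar S F m)
    × IsFrobenius (bar S F m) F
    × (∀ g → IsGenus S g → IsGenus (bar S F m) g)
    × (Σ ℕ λ m′ → IsMultiplicity (bar S F m) m′ × (m < m′))
    × (∀ n → θ F (bar S F m) n ⇔ θ F S n)
lemma8 S S-ns F m F-frob m-mult 2m<F =
  B-isNumericalSemigroup , B-isFrobenius , B-isGenus , B-multiplicity ,
  θ-exchange exchange refl 0<m 2m<F
  where open SmallMultiplicityExchange S-ns F-frob m-mult 2m<F
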